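{- Let $s\ge1$ and let $k_1>k_2>\dots>k_s$ be integers with $k_j-k_{j+1}\ge 2$ for all $1\le j<s$. If $k_1$ is even, then \[(-1)^{k_1}\varphi^{k_1}+(-1)^{k_2}\varphi^{k_2}+\dots+(-1)^{k_s}\varphi^{k_s}>0,\] and if $k_1$ is odd, then \[(-1)^{k_1}\varphi^{k_1}+(-1)^{k_2}\varphi^{k_2}+\dots+(-1)^{k_s}\varphi^{k_s}<0.\]
   Context: $\varphi=\frac{1+\sqrt5}{2}$ is the golden ratio. -}

module Defs where

open import Data.Nat as ℕ using (ℕ; zero; suc)
open import Data.Integer as ℤ using (ℤ; +_; -[1+_]; _+_; _*_; -_; _<_; _≤_)
open import Data.Product using (_×_; _,_)
open import Data.Sum using (_⊎_)

-- Exact arithmetic in the subring ℤ[φ] of the reals, φ = (1+√5)/2.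
-- An element  a + b·φ  is represented by the pair of integers (a , b).
record ℤφ : Set where
  constructor _+_φ
  field
    re : ℤ
    im : ℤ
open ℤφ public

infixl 6 _⊕_
infixl 7 _⊗_

_⊕_ : ℤφ → ℤφ → ℤφ
(a + b φ) ⊕ (c + d φ) = (a + c) + (b + d) φ

-- uses φ² = φ + 1
_⊗_ : ℤφ → ℤφ → ℤφ
(a + b φ) ⊗ (c + d φ) = (a * c + b * d) + (a * d + b * c + b * d) φ

𝟘 𝟙 : ℤφ
𝟘 = (+ 0) + (+ 0) φ
𝟙 = (+ 1) + (+ 0) φ

-- the number  -φ   and its inverse  (-φ)⁻¹ = 1 - φ   (since φ⁻¹ = φ - 1)
negφ negφ⁻¹ : ℤφ
negφ   = (+ 0) + (ℤ.-[1+ 0 ]) φ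
negφ⁻¹ = (+ 1) + (ℤ.-[1+ 0 ]) φ

_^ℕ_ : ℤφ → ℕ → ℤφ
x ^ℕ zero  = 𝟙
x ^ℕ suc n = x ⊗ (x ^ℕ n)

-- (-1)^k φ^k = (-φ)^k  for an integer exponent k
sgnφpow : ℤ → ℤφ
sgnφpow (+ n)      = negφ ^ℕ n
sgnφpow -[1+ n ]   = negφ⁻¹ ^ℕ suc n

sumφ : ℕ → (ℕ → ℤφ) → ℤφ
sumφ zero    x = 𝟘
sumφ (suc s) x = sumφ s x ⊕ x s

-- Real positivity of  p + q·√5  (p, q integers), using only √5 ≥ 0 and (√5)² = 5:
--   q ≥ 0, p > 0                    : positive
--   q > 0, p ≤ 0, p² < 5q²          : positive  (q√5 > -p)
--   q < 0, p > 0, 5q² < p²          : positive  (p > -q√5)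
-- and these are the only cases in which p + q√5 > 0.
Pos√5 : ℤ → ℤ → Set
Pos√5 p q =
    ((+ 0) < p × (+ 0) ≤ q)
  ⊎ ((p ≤ + 0 × (+ 0) < q) × p * p < (+ 5) * (q * q))
  ⊎ (((+ 0) < p × q < + 0) × (+ 5) * (q * q) < p * p)

-- a + bφ = ((2a + b) + b√5)/2, so a + bφ > 0 iff (2a+b) + b√5 > 0.
Positive : ℤφ → Set
Positive (a + b φ) = Pos√5 ((+ 2) * a + b) b

Negative : ℤφ → Set
Negative (a + b φ) = Positive ((- a) + (- b) φ)

{-# OPTIONS --safe #-}
module Submission where

-- Since (-φ)^k = ±φ^k and φ^(k+1) = φ^k + φ^(k-1), induction from the smallest
-- exponent shows that a sum whose largest exponent is k has absolute value
-- below φ^(k+1).  The tail after the leading term has largest exponent at most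
-- k₁ - 2, so the whole sum is ±(φ^k₁ + t) with |t| < φ^(k₁-1), and
-- φ^k₁ + t > φ^k₁ - φ^(k₁-1) = φ^(k₁-2) > 0.  All of this is computed exactly
-- in ℤ[φ], where positivity is certified by some φⁿz having coordinates in the
-- cone a ≥ 0, b > 0.

open import Defs
open import Data.Nat using (ℕ; suc)
open import Data.Integer using (ℤ; +_; _+_; _≤_)
open import Data.Integer.Divisibility using (_∣_)
open import Relation.Nullary using (¬_)
open import Data.Product using (_×_)

open import Data.Nat as ℕ using (zero; s≤s; z≤n)
import Data.Nat.Properties as ℕ
open import Data.Nat.Divisibility using (_∣?_; _∣0; ∣-refl; ∣m∣n⇒∣m+n; ∣m+n∣m⇒∣n; >⇒∤) renaming (_∣_ to _∣ℕ_)
open import Data.Nat.GeneralisedArithmetic using (fold)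
open import Data.Integer as ℤ using (-_; _-_; _*_; _<_; -[1+_]; +[1+_]; +<+; +≤+; ∣_∣)
import Data.Integer.Properties as ℤ
open import Data.Integer.Tactic.RingSolver using (solve-∀)
open import Data.Product using (∃-syntax; _,_)
open import Data.Sum using (_⊎_; inj₁; inj₂)
open import Function using (_∘_)
open import Relation.Nullary using (Dec; yes; no; contradiction)
open import Relation.Binary.PropositionalEquality

0<*0< : ∀ {i j} → + 0 < i → + 0 < j → + 0 < i * j
0<*0< {+[1+ _ ]} {+[1+ _ ]} _         _         = +<+ (s≤s z≤n)
0<*0< {+ 0}                  (+<+ ()) _
0<*0< { -[1+ _ ]}            ()       _
0<*0< {+[1+ _ ]} {+ 0}       _         (+<+ ())
0<*0< {+[1+ _ ]} { -[1+ _ ]} _         ()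

0≤*0≤ : ∀ {i j} → + 0 ≤ i → + 0 ≤ j → + 0 ≤ i * j
0≤*0≤ {+ m} {+ n} _ _ = subst (+ 0 ≤_) (ℤ.pos-* m n) (+≤+ z≤n)

i<j⇒0<j-i : ∀ {i j} → i < j → + 0 < j - i
i<j⇒0<j-i {i} {j} i<j = subst (_< j - i) (ℤ.+-inverseʳ i) (ℤ.+-monoˡ-< (- i) i<j)

i-j+j≡i : ∀ i j → i - j + j ≡ i
i-j+j≡i = solve-∀

0<j-i⇒i<j : ∀ {i j} → + 0 < j - i → i < j
0<j-i⇒i<j {i} {j} 0<j-i = subst₂ _<_ (ℤ.+-identityˡ i) (i-j+j≡i j i) (ℤ.+-monoˡ-< i 0<j-i)

neg : ℤφ → ℤφ
neg (a + b φ) = (- a) + (- b) φ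

infixl 6 _⊖_
_⊖_ : ℤφ → ℤφ → ℤφ
x ⊖ y = x ⊕ neg y

⊕-assoc : ∀ x y z → (x ⊕ y) ⊕ z ≡ x ⊕ (y ⊕ z)
⊕-assoc x y z = cong₂ _+_φ (ℤ.+-assoc (re x) (re y) (re z)) (ℤ.+-assoc (im x) (im y) (im z))

⊕-identityˡ : ∀ x → 𝟘 ⊕ x ≡ x
⊕-identityˡ x = cong₂ _+_φ (ℤ.+-identityˡ (re x)) (ℤ.+-identityˡ (im x))

⊕-identityʳ : ∀ x → x ⊕ 𝟘 ≡ x
⊕-identityʳ x = cong₂ _+_φ (ℤ.+-identityʳ (re x)) (ℤ.+-identityʳ (im x))

neg-involutive : ∀ x → neg (neg x) ≡ x
neg-involutive x = cong₂ _+_φ (ℤ.neg-involutive (re x)) (ℤ.neg-involutive (im x))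

neg-distrib-⊕ : ∀ x y → neg (x ⊕ y) ≡ neg x ⊕ neg y
neg-distrib-⊕ x y = cong₂ _+_φ (ℤ.neg-distrib-+ (re x) (re y)) (ℤ.neg-distrib-+ (im x) (im y))

⊖-telescope : ∀ x y z → (z ⊖ y) ⊕ (y ⊖ x) ≡ z ⊖ x
⊖-telescope x y z = cong₂ _+_φ (ℤ.+-minus-telescope (re z) (re y) (re x)) (ℤ.+-minus-telescope (im z) (im y) (im x))

-- (a + bφ)φ = b + (a + b)φ  and  (a + bφ)/φ = (a + bφ)(φ - 1) = (b - a) + aφ,  as φ² = φ + 1.
φ·_ φ⁻¹·_ : ℤφ → ℤφ
φ·   (a + b φ) = b + (a + b) φ
φ⁻¹· (a + b φ) = (b - a) + a φ

φ·-⊕ : ∀ x y → φ· (x ⊕ y) ≡ φ· x ⊕ φ· y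
φ·-⊕ (a + b φ) (c + d φ) = cong₂ _+_φ refl (shuffle a b c d)
  where
  shuffle : ∀ a b c d → (a + c) + (b + d) ≡ (a + b) + (c + d)
  shuffle = solve-∀

φ·-neg : ∀ x → φ· (neg x) ≡ neg (φ· x)
φ·-neg (a + b φ) = cong₂ _+_φ refl (sym (ℤ.neg-distrib-+ a b))

φ⁻¹·-neg : ∀ x → φ⁻¹· (neg x) ≡ neg (φ⁻¹· x)
φ⁻¹·-neg (a + b φ) = cong₂ _+_φ (negate a b) refl
  where
  negate : ∀ a b → - b - - a ≡ - (b - a)
  negate = solve-∀

φ·-φ⁻¹· : ∀ x → φ· (φ⁻¹· x) ≡ x
φ·-φ⁻¹· (a + b φ) = cong₂ _+_φ refl (i-j+j≡i b a)

φ·y⊖y≡φ⁻¹·y : ∀ y → φ· y ⊖ y ≡ φ⁻¹· y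
φ·y⊖y≡φ⁻¹·y (a + b φ) = cong₂ _+_φ refl (cancel a b)
  where
  cancel : ∀ a b → (a + b) - b ≡ a
  cancel = solve-∀

φ·-⊕-split : ∀ y t → φ· y ⊕ t ≡ φ⁻¹· y ⊕ (y ⊖ neg t)
φ·-⊕-split (a + b φ) (c + d φ) = cong₂ _+_φ (split-re a b c) (split-im a b d)
  where
  split-re : ∀ a b c → b + c ≡ (b - a) + (a - - c)
  split-re = solve-∀
  split-im : ∀ a b d → (a + b) + d ≡ a + (b - - d)
  split-im = solve-∀

φ·φ·-⊖ : ∀ y t → φ· (φ· y) ⊖ (φ· y ⊕ t) ≡ y ⊖ t
φ·φ·-⊖ (a + b φ) (c + d φ) = cong₂ _+_φ (cancel-re a b c) (cancel-im a b d)
  where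
  cancel-re : ∀ a b c → (a + b) - (b + c) ≡ a - c
  cancel-re = solve-∀
  cancel-im : ∀ a b d → (b + (a + b)) - ((a + b) + d) ≡ b - d
  cancel-im = solve-∀

negφ-⊗ : ∀ x → negφ ⊗ x ≡ neg (φ· x)
negφ-⊗ (a + b φ) = cong₂ _+_φ (re-id a b) (im-id a b)
  where
  re-id : ∀ a b → + 0 * a + - + 1 * b ≡ - b
  re-id = solve-∀
  im-id : ∀ a b → + 0 * b + - + 1 * a + - + 1 * b ≡ - (a + b)
  im-id = solve-∀

negφ⁻¹-⊗ : ∀ x → negφ⁻¹ ⊗ x ≡ neg (φ⁻¹· x)
negφ⁻¹-⊗ (a + b φ) = cong₂ _+_φ (re-id a b) (im-id a b)
  where
  re-id : ∀ a b → + 1 * a + - + 1 * b ≡ - (b - a)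
  re-id = solve-∀
  im-id : ∀ a b → + 1 * b + - + 1 * a + - + 1 * b ≡ - a
  im-id = solve-∀

-- Positive (a + bφ) is Pos√5 p b with p = 2a + b; Positive (φ·(a + bφ)) is
-- Pos√5 p′ q′ with p′ = 2b + (a + b), q′ = a + b.
reflects-cone : ∀ a b → + 0 < + 2 * b + (a + b) → + 0 ≤ a + b → Pos√5 (+ 2 * a + b) b
reflects-cone a b 0<p′ 0≤q′ with + 0 ℤ.≤? b | + 0 ℤ.<? + 2 * a + b
... | yes 0≤b | yes 0<p = inj₁ (0<p , 0≤b)
... | yes 0≤b | no  0≮p = inj₂ (inj₁ ((p≤0 , 0<b) , 0<j-i⇒i<j (subst (+ 0 <_) (norm a b) 0<norm)))
  where
  p≤0 : + 2 * a + b ≤ + 0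
  p≤0 = ℤ.≮⇒≥ 0≮p
  five-b : ∀ a b → + 2 * (+ 2 * b + (a + b)) - (+ 2 * a + b) ≡ + 5 * b
  five-b = solve-∀
  0<b : + 0 < b
  0<b = ℤ.*-cancelˡ-<-nonNeg {+ 0} (+ 5)
          (subst (+ 0 <_) (five-b a b) (ℤ.+-mono-<-≤ (0<*0< (ℤ.positive⁻¹ (+ 2)) 0<p′) (ℤ.neg-mono-≤ p≤0)))
  norm : ∀ a b → + 4 * (b * b) + (+ 2 * (a + b)) * (b - (+ 2 * a + b))
               ≡ + 5 * (b * b) - (+ 2 * a + b) * (+ 2 * a + b)
  norm = solve-∀
  0<norm : + 0 < + 4 * (b * b) + (+ 2 * (a + b)) * (b - (+ 2 * a + b))
  0<norm = ℤ.+-mono-<-≤ (0<*0< (ℤ.positive⁻¹ (+ 4)) (0<*0< 0<b 0<b))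
             (0≤*0≤ (0≤*0≤ (ℤ.nonNegative⁻¹ (+ 2)) 0≤q′) (ℤ.+-mono-≤ 0≤b (ℤ.neg-mono-≤ p≤0)))
... | no 0≰b | _ = inj₂ (inj₂ ((0<p , b<0) , 0<j-i⇒i<j (subst (+ 0 <_) (norm a b) 0<norm)))
  where
  b<0 : b < + 0
  b<0 = ℤ.≰⇒> 0≰b
  0<-b : + 0 < - b
  0<-b = ℤ.neg-mono-< b<0
  p-id : ∀ a b → + 2 * (+ 2 * b + (a + b)) + + 5 * (- b) ≡ + 2 * a + b
  p-id = solve-∀
  0<p : + 0 < + 2 * a + b
  0<p = subst (+ 0 <_) (p-id a b) (ℤ.+-mono-< (0<*0< (ℤ.positive⁻¹ (+ 2)) 0<p′) (0<*0< (ℤ.positive⁻¹ (+ 5)) 0<-b))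
  norm : ∀ a b → (+ 2 * (+ 2 * b + (a + b))) * ((+ 2 * a + b) + + 5 * (- b)) + + 20 * ((- b) * (- b))
               ≡ (+ 2 * a + b) * (+ 2 * a + b) - + 5 * (b * b)
  norm = solve-∀
  0<norm : + 0 < (+ 2 * (+ 2 * b + (a + b))) * ((+ 2 * a + b) + + 5 * (- b)) + + 20 * ((- b) * (- b))
  0<norm = ℤ.+-mono-< (0<*0< (0<*0< (ℤ.positive⁻¹ (+ 2)) 0<p′) (ℤ.+-mono-< 0<p (0<*0< (ℤ.positive⁻¹ (+ 5)) 0<-b)))
                      (0<*0< (ℤ.positive⁻¹ (+ 20)) (0<*0< 0<-b 0<-b))

-- Multiplication by φ negates the norm p² - 5q².
norm-φ· : ∀ a b → (+ 2 * a + b) * (+ 2 * a + b) - + 5 * (b * b)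
                ≡ + 5 * ((a + b) * (a + b)) - (+ 2 * b + (a + b)) * (+ 2 * b + (a + b))
norm-φ· = solve-∀

reflects-negative-norm : ∀ a b → + 2 * b + (a + b) ≤ + 0 → + 0 < a + b
  → (+ 2 * b + (a + b)) * (+ 2 * b + (a + b)) < + 5 * ((a + b) * (a + b))
  → Pos√5 (+ 2 * a + b) b
reflects-negative-norm a b p′≤0 0<q′ norm′<0 =
  inj₂ (inj₂ ((0<p , b<0) , 0<j-i⇒i<j (subst (+ 0 <_) (sym (norm-φ· a b)) (i<j⇒0<j-i norm′<0))))
  where
  two-b : ∀ a b → (a + b) - (+ 2 * b + (a + b)) ≡ + 2 * (- b)
  two-b = solve-∀
  0<-b : + 0 < - b
  0<-b = ℤ.*-cancelˡ-<-nonNeg {+ 0} (+ 2)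
           (subst (+ 0 <_) (two-b a b) (ℤ.+-mono-<-≤ 0<q′ (ℤ.neg-mono-≤ p′≤0)))
  b<0 : b < + 0
  b<0 = ℤ.neg-cancel-< {+ 0} {b} 0<-b
  p-id : ∀ a b → + 2 * (a + b) + - b ≡ + 2 * a + b
  p-id = solve-∀
  0<p : + 0 < + 2 * a + b
  0<p = subst (+ 0 <_) (p-id a b) (ℤ.+-mono-< (0<*0< (ℤ.positive⁻¹ (+ 2)) 0<q′) 0<-b)

reflects-positive-norm : ∀ a b → + 0 < + 2 * b + (a + b) → a + b < + 0
  → + 5 * ((a + b) * (a + b)) < (+ 2 * b + (a + b)) * (+ 2 * b + (a + b))
  → Pos√5 (+ 2 * a + b) b
reflects-positive-norm a b 0<p′ q′<0 norm′>0 =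
  inj₂ (inj₁ ((p≤0 , 0<b) , 0<j-i⇒i<j (subst (+ 0 <_) (norm a b) (i<j⇒0<j-i norm′>0))))
  where
  two-b : ∀ a b → (+ 2 * b + (a + b)) - (a + b) ≡ + 2 * b
  two-b = solve-∀
  0<b : + 0 < b
  0<b = ℤ.*-cancelˡ-<-nonNeg {+ 0} (+ 2)
          (subst (+ 0 <_) (two-b a b) (ℤ.+-mono-< 0<p′ (ℤ.neg-mono-< q′<0)))
  -p-id : ∀ a b → + 2 * (- (a + b)) + b ≡ - (+ 2 * a + b)
  -p-id = solve-∀
  p≤0 : + 2 * a + b ≤ + 0
  p≤0 = ℤ.neg-cancel-≤ {+ 0} (subst (+ 0 ≤_) (-p-id a b)
          (ℤ.+-mono-≤ (0≤*0≤ (ℤ.nonNegative⁻¹ (+ 2)) (ℤ.<⇒≤ (ℤ.neg-mono-< q′<0))) (ℤ.<⇒≤ 0<b)))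
  norm : ∀ a b → (+ 2 * b + (a + b)) * (+ 2 * b + (a + b)) - + 5 * ((a + b) * (a + b))
               ≡ + 5 * (b * b) - (+ 2 * a + b) * (+ 2 * a + b)
  norm = solve-∀

φ·-reflects-Positive : ∀ z → Positive (φ· z) → Positive z
φ·-reflects-Positive (a + b φ) (inj₁ (0<p′ , 0≤q′))                = reflects-cone a b 0<p′ 0≤q′
φ·-reflects-Positive (a + b φ) (inj₂ (inj₁ ((p′≤0 , 0<q′) , n′)))   = reflects-negative-norm a b p′≤0 0<q′ n′
φ·-reflects-Positive (a + b φ) (inj₂ (inj₂ ((0<p′ , q′<0) , n′)))   = reflects-positive-norm a b 0<p′ q′<0 n′

InCone : ℤφ → Set
InCone z = + 0 ≤ re z × + 0 < im z

InCone-⊕ : ∀ {x y} → InCone x → InCone y → InCone (x ⊕ y)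
InCone-⊕ (0≤a , 0<b) (0≤c , 0<d) = ℤ.+-mono-≤ 0≤a 0≤c , ℤ.+-mono-< 0<b 0<d

InCone-φ· : ∀ {z} → InCone z → InCone (φ· z)
InCone-φ· (0≤a , 0<b) = ℤ.<⇒≤ 0<b , ℤ.+-mono-≤-< 0≤a 0<b

InCone⇒Positive : ∀ z → InCone z → Positive z
InCone⇒Positive _ (0≤a , 0<b) =
  inj₁ (ℤ.+-mono-≤-< (0≤*0≤ (ℤ.nonNegative⁻¹ (+ 2)) 0≤a) 0<b , ℤ.<⇒≤ 0<b)

φ^_·_ : ℕ → ℤφ → ℤφ
φ^ n · z = fold z φ·_ n

φ^·-⊕ : ∀ n x y → φ^ n · (x ⊕ y) ≡ φ^ n · x ⊕ φ^ n · y
φ^·-⊕ zero    x y = refl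
φ^·-⊕ (suc n) x y = trans (cong φ·_ (φ^·-⊕ n x y)) (φ·-⊕ (φ^ n · x) (φ^ n · y))

φ^·-φ· : ∀ n z → φ^ n · (φ· z) ≡ φ· (φ^ n · z)
φ^·-φ· zero    z = refl
φ^·-φ· (suc n) z = cong φ·_ (φ^·-φ· n z)

InCone-φ^· : ∀ m {n} {z} → InCone (φ^ n · z) → InCone (φ^ (m ℕ.+ n) · z)
InCone-φ^· zero    h = h
InCone-φ^· (suc m) h = InCone-φ· (InCone-φ^· m h)

Positive-φ^· : ∀ n {z} → Positive (φ^ n · z) → Positive z
Positive-φ^· zero    h = h
Positive-φ^· (suc n) {z} h = Positive-φ^· n (φ·-reflects-Positive (φ^ n · z) h)

-- Since φⁿ(a + bφ) = (F₍ₙ₋₁₎a + Fₙb) + (Fₙa + F₍ₙ₊₁₎b)φ, a nonzero z is positive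
-- iff all large enough φⁿz lie in the cone; unlike Positive, this is visibly
-- closed under addition, and √5 only enters through Pos⇒Positive.
Pos : ℤφ → Set
Pos z = ∃[ n ] InCone (φ^ n · z)

Pos⇒Positive : ∀ {z} → Pos z → Positive z
Pos⇒Positive {z} (n , h) = Positive-φ^· n (InCone⇒Positive (φ^ n · z) h)

Pos-𝟙 : Pos 𝟙
Pos-𝟙 = 1 , ℤ.nonNegative⁻¹ (+ 0) , ℤ.positive⁻¹ (+ 1)

Pos-⊕ : ∀ {x y} → Pos x → Pos y → Pos (x ⊕ y)
Pos-⊕ {x} {y} (m , hx) (n , hy) = n ℕ.+ m , subst InCone (sym (φ^·-⊕ (n ℕ.+ m) x y)) (InCone-⊕ hx′ hy′)
  where
  hx′ : InCone (φ^ (n ℕ.+ m) · x)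
  hx′ = InCone-φ^· n hx
  hy′ : InCone (φ^ (n ℕ.+ m) · y)
  hy′ = subst (λ l → InCone (φ^ l · y)) (ℕ.+-comm m n) (InCone-φ^· m hy)

Pos-φ· : ∀ {z} → Pos z → Pos (φ· z)
Pos-φ· {z} (n , h) = n , subst InCone (sym (φ^·-φ· n z)) (InCone-φ· h)

Pos-φ⁻¹· : ∀ {z} → Pos z → Pos (φ⁻¹· z)
Pos-φ⁻¹· {z} (n , h) = suc n , subst InCone (sym φ^[1+n]·φ⁻¹·z≡φ^n·z) h
  where
  φ^[1+n]·φ⁻¹·z≡φ^n·z : φ^ suc n · (φ⁻¹· z) ≡ φ^ n · z
  φ^[1+n]·φ⁻¹·z≡φ^n·z = trans (sym (φ^·-φ· n (φ⁻¹· z))) (cong (φ^ n ·_) (φ·-φ⁻¹· z))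

Pos-fold : ∀ {f} → (∀ {z} → Pos z → Pos (f z)) → ∀ {z} → Pos z → ∀ n → Pos (fold z f n)
Pos-fold Pos-f h zero    = h
Pos-fold Pos-f h (suc n) = Pos-f (Pos-fold Pos-f h n)

infix 4 _<φ_ _≤φ_ ∣_∣<_

_<φ_ : ℤφ → ℤφ → Set
x <φ y = Pos (y ⊖ x)

_≤φ_ : ℤφ → ℤφ → Set
x ≤φ y = x ≡ y ⊎ x <φ y

record ∣_∣<_ (z r : ℤφ) : Set where
  constructor within
  field
    upper : z <φ r
    lower : neg z <φ r

<φ-trans : ∀ {x y z} → x <φ y → y <φ z → x <φ z
<φ-trans {x} {y} {z} x<y y<z = subst Pos (⊖-telescope x y z) (Pos-⊕ y<z x<y)

<-≤φ-trans : ∀ {x y z} → x <φ y → y ≤φ z → x <φ z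
<-≤φ-trans x<y (inj₁ refl)          = x<y
<-≤φ-trans {x} {y} {z} x<y (inj₂ y<z) = <φ-trans {x} {y} {z} x<y y<z

≤-<φ-trans : ∀ {x y z} → x ≤φ y → y <φ z → x <φ z
≤-<φ-trans (inj₁ refl) y<z          = y<z
≤-<φ-trans {x} {y} {z} (inj₂ x<y) y<z = <φ-trans {x} {y} {z} x<y y<z

<φ-φ· : ∀ {y} → Pos y → y <φ φ· y
<φ-φ· {y} 0<y = subst Pos (sym (φ·y⊖y≡φ⁻¹·y y)) (Pos-φ⁻¹· 0<y)

∣𝟘∣< : ∀ {r} → Pos r → ∣ 𝟘 ∣< r
∣𝟘∣< {r} 0<r = within 0<r′ 0<r′
  where
  0<r′ : 𝟘 <φ r
  0<r′ = subst Pos (sym (⊕-identityʳ r)) 0<r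

∣∣<-neg : ∀ {z r} → ∣ z ∣< r → ∣ neg z ∣< r
∣∣<-neg {z} {r} (within z<r -z<r) = within -z<r (subst (_<φ r) (sym (neg-involutive z)) z<r)

∣∣<-weaken : ∀ {z r s} → ∣ z ∣< r → r ≤φ s → ∣ z ∣< s
∣∣<-weaken {z} {r} {s} (within z<r -z<r) r≤s =
  within (<-≤φ-trans {z} {r} {s} z<r r≤s) (<-≤φ-trans {neg z} {r} {s} -z<r r≤s)

φ^ᶻ_ : ℤ → ℤφ
φ^ᶻ (+ n)    = φ^ n · 𝟙
φ^ᶻ -[1+ n ] = fold 𝟙 φ⁻¹·_ (suc n)

φ^ᶻ-suc : ∀ k → φ^ᶻ (ℤ.suc k) ≡ φ· (φ^ᶻ k)
φ^ᶻ-suc (+ n)          = refl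
φ^ᶻ-suc -[1+ zero ]    = sym (φ·-φ⁻¹· 𝟙)
φ^ᶻ-suc -[1+ suc n ]   = sym (φ·-φ⁻¹· (φ^ᶻ -[1+ n ]))

φ^ᶻ-pred : ∀ k → φ^ᶻ k ≡ φ· (φ^ᶻ (ℤ.pred k))
φ^ᶻ-pred k = trans (cong φ^ᶻ_ (sym (ℤ.suc-pred k))) (φ^ᶻ-suc (ℤ.pred k))

φ·φ·φ^ᶻ-pred : ∀ k → φ· (φ· (φ^ᶻ (ℤ.pred k))) ≡ φ^ᶻ (ℤ.suc k)
φ·φ·φ^ᶻ-pred k = sym (trans (φ^ᶻ-suc k) (cong φ·_ (φ^ᶻ-pred k)))

Pos-φ^ᶻ : ∀ k → Pos (φ^ᶻ k)
Pos-φ^ᶻ (+ n)    = Pos-fold Pos-φ· Pos-𝟙 n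
Pos-φ^ᶻ -[1+ n ] = Pos-fold Pos-φ⁻¹· Pos-𝟙 (suc n)

φ^ᶻ-+-mono : ∀ n i → φ^ᶻ i ≤φ φ^ᶻ (+ n + i)
φ^ᶻ-+-mono zero    i = inj₁ (cong φ^ᶻ_ (sym (ℤ.+-identityˡ i)))
φ^ᶻ-+-mono (suc n) i = inj₂ (subst (φ^ᶻ i <φ_) (sym φ^ᶻ-1+n+i)
                              (≤-<φ-trans {z = φ· (φ^ᶻ (+ n + i))} (φ^ᶻ-+-mono n i) (<φ-φ· (Pos-φ^ᶻ (+ n + i)))))
  where
  φ^ᶻ-1+n+i : φ^ᶻ (+ suc n + i) ≡ φ· (φ^ᶻ (+ n + i))
  φ^ᶻ-1+n+i = trans (cong φ^ᶻ_ (ℤ.+-assoc (+ 1) (+ n) i)) (φ^ᶻ-suc (+ n + i))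

φ^ᶻ-mono-≤ : ∀ {i j} → i ≤ j → φ^ᶻ i ≤φ φ^ᶻ j
φ^ᶻ-mono-≤ {i} {j} i≤j = subst (λ k → φ^ᶻ i ≤φ φ^ᶻ k) j≡∣j-i∣+i (φ^ᶻ-+-mono ∣ j - i ∣ i)
  where
  j≡∣j-i∣+i : + ∣ j - i ∣ + i ≡ j
  j≡∣j-i∣+i = trans (cong (_+ i) (ℤ.0≤i⇒+∣i∣≡i (ℤ.i≤j⇒0≤j-i i≤j))) (i-j+j≡i j i)

module Alternating (f : ℤφ → ℤφ) (f-neg : ∀ z → f (neg z) ≡ neg (f z))
                   (x : ℤφ) (x⊗ : ∀ z → x ⊗ z ≡ neg (f z)) where

  x⊗x⊗ : ∀ z → x ⊗ (x ⊗ z) ≡ f (f z)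
  x⊗x⊗ z = begin
    x ⊗ (x ⊗ z)          ≡⟨ x⊗ (x ⊗ z) ⟩
    neg (f (x ⊗ z))      ≡⟨ cong (neg ∘ f) (x⊗ z) ⟩
    neg (f (neg (f z)))  ≡⟨ cong neg (f-neg (f z)) ⟩
    neg (neg (f (f z)))  ≡⟨ neg-involutive (f (f z)) ⟩
    f (f z)              ∎
    where open ≡-Reasoning

  ^ℕ-even : ∀ n → 2 ∣ℕ n → x ^ℕ n ≡ fold 𝟙 f n
  ^ℕ-even zero          _   = refl
  ^ℕ-even (suc zero)    2∣1 = contradiction 2∣1 (>⇒∤ (s≤s (s≤s z≤n)))
  ^ℕ-even (suc (suc n)) 2∣n+2 =
    trans (x⊗x⊗ (x ^ℕ n)) (cong (f ∘ f) (^ℕ-even n (∣m+n∣m⇒∣n 2∣n+2 ∣-refl)))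

  ^ℕ-odd : ∀ n → ¬ 2 ∣ℕ n → x ^ℕ n ≡ neg (fold 𝟙 f n)
  ^ℕ-odd zero          2∤0   = contradiction (2 ∣0) 2∤0
  ^ℕ-odd (suc zero)    _     = x⊗ 𝟙
  ^ℕ-odd (suc (suc n)) 2∤n+2 = begin
    x ⊗ (x ⊗ x ^ℕ n)                ≡⟨ x⊗x⊗ (x ^ℕ n) ⟩
    f (f (x ^ℕ n))                  ≡⟨ cong (f ∘ f) (^ℕ-odd n (2∤n+2 ∘ ∣m∣n⇒∣m+n ∣-refl)) ⟩
    f (f (neg (fold 𝟙 f n)))        ≡⟨ cong f (f-neg (fold 𝟙 f n)) ⟩
    f (neg (f (fold 𝟙 f n)))        ≡⟨ f-neg (f (fold 𝟙 f n)) ⟩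
    neg (fold 𝟙 f (suc (suc n)))    ∎
    where open ≡-Reasoning

open Alternating φ·_   φ·-neg   negφ   negφ-⊗   renaming (^ℕ-even to negφ^-even;   ^ℕ-odd to negφ^-odd)
open Alternating φ⁻¹·_ φ⁻¹·-neg negφ⁻¹ negφ⁻¹-⊗ renaming (^ℕ-even to negφ⁻¹^-even; ^ℕ-odd to negφ⁻¹^-odd)

sgnφpow-even : ∀ k → + 2 ∣ k → sgnφpow k ≡ φ^ᶻ k
sgnφpow-even (+ n)    = negφ^-even n
sgnφpow-even -[1+ n ] = negφ⁻¹^-even (suc n)

sgnφpow-odd : ∀ k → ¬ (+ 2 ∣ k) → sgnφpow k ≡ neg (φ^ᶻ k)
sgnφpow-odd (+ n)    = negφ^-odd n
sgnφpow-odd -[1+ n ] = negφ⁻¹^-odd (suc n)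

sgnφpow-⊕-even : ∀ k t → + 2 ∣ k → sgnφpow k ⊕ t ≡ φ· (φ^ᶻ (ℤ.pred k)) ⊕ t
sgnφpow-⊕-even k t 2∣k = cong (_⊕ t) (trans (sgnφpow-even k 2∣k) (φ^ᶻ-pred k))

sgnφpow-⊕-odd : ∀ k t → ¬ (+ 2 ∣ k) → neg (sgnφpow k ⊕ t) ≡ φ· (φ^ᶻ (ℤ.pred k)) ⊕ neg t
sgnφpow-⊕-odd k t 2∤k = begin
  neg (sgnφpow k ⊕ t)               ≡⟨ neg-distrib-⊕ (sgnφpow k) t ⟩
  neg (sgnφpow k) ⊕ neg t           ≡⟨ cong (λ u → neg u ⊕ neg t) (sgnφpow-odd k 2∤k) ⟩
  neg (neg (φ^ᶻ k)) ⊕ neg t         ≡⟨ cong (_⊕ neg t) (trans (neg-involutive (φ^ᶻ k)) (φ^ᶻ-pred k)) ⟩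
  φ· (φ^ᶻ (ℤ.pred k)) ⊕ neg t       ∎
  where open ≡-Reasoning

sumφ-suc : ∀ s f → sumφ (suc s) f ≡ f 0 ⊕ sumφ s (f ∘ suc)
sumφ-suc zero    f = trans (⊕-identityˡ (f 0)) (sym (⊕-identityʳ (f 0)))
sumφ-suc (suc s) f = trans (cong (_⊕ f (suc s)) (sumφ-suc s f)) (⊕-assoc (f 0) (sumφ s (f ∘ suc)) (f (suc s)))

φ·-dominates : ∀ {y t} → Pos y → ∣ t ∣< y → Pos (φ· y ⊕ t)
φ·-dominates {y} {t} 0<y (within _ -t<y) = subst Pos (sym (φ·-⊕-split y t)) (Pos-⊕ (Pos-φ⁻¹· 0<y) -t<y)

∣φ·-dominates∣< : ∀ {y t} → Pos y → ∣ t ∣< y → ∣ φ· y ⊕ t ∣< φ· (φ· y)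
∣φ·-dominates∣< {y} {t} 0<y ∣t∣<y@(within t<y _) =
  within (subst Pos (sym (φ·φ·-⊖ y t)) t<y)
  (subst Pos (cong (φ· (φ· y) ⊕_) (sym (neg-involutive (φ· y ⊕ t))))
    (Pos-⊕ (Pos-φ· (Pos-φ· 0<y)) (φ·-dominates 0<y ∣t∣<y)))

∣sgnφpow-⊕∣< : ∀ k {t} → ∣ t ∣< φ^ᶻ (ℤ.pred k) → ∣ sgnφpow k ⊕ t ∣< φ^ᶻ (ℤ.suc k)
∣sgnφpow-⊕∣< k {t} ∣t∣<y = subst (∣ sgnφpow k ⊕ t ∣<_) (φ·φ·φ^ᶻ-pred k) (bound (2 ∣? ∣ k ∣))
  where
  0<y : Pos (φ^ᶻ (ℤ.pred k))
  0<y = Pos-φ^ᶻ (ℤ.pred k)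
  bound : Dec (+ 2 ∣ k) → ∣ sgnφpow k ⊕ t ∣< φ· (φ· (φ^ᶻ (ℤ.pred k)))
  bound (yes 2∣k) = subst (∣_∣< _) (sym (sgnφpow-⊕-even k t 2∣k)) (∣φ·-dominates∣< 0<y ∣t∣<y)
  bound (no 2∤k)  = subst (∣_∣< _) (neg-involutive (sgnφpow k ⊕ t))
    (∣∣<-neg (subst (∣_∣< _) (sym (sgnφpow-⊕-odd k t 2∤k)) (∣φ·-dominates∣< 0<y (∣∣<-neg ∣t∣<y))))

Sparse : ℕ → (ℕ → ℤ) → Set
Sparse s k = ∀ j → suc j ℕ.< s → k (suc j) + + 2 ≤ k j

suc-≤-pred : ∀ {i j} → i + + 2 ≤ j → ℤ.suc i ≤ ℤ.pred j
suc-≤-pred {i} {j} i+2≤j = subst (_≤ ℤ.pred j) (shift i) (ℤ.+-monoʳ-≤ (- + 1) i+2≤j)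
  where
  shift : ∀ i → - + 1 + (i + + 2) ≡ + 1 + i
  shift = solve-∀

∣tail∣< : ∀ s k → Sparse (suc s) k → ∣ sumφ s (λ j → sgnφpow (k (suc j))) ∣< φ^ᶻ (ℤ.pred (k 0))
∣tail∣< zero    k _      = ∣𝟘∣< (Pos-φ^ᶻ (ℤ.pred (k 0)))
∣tail∣< (suc s) k sparse = ∣∣<-weaken ∣tail∣<φ^[k₁+1] (φ^ᶻ-mono-≤ (suc-≤-pred {k 1} (sparse 0 (s≤s (s≤s z≤n)))))
  where
  ∣tail∣<φ^[k₁+1] : ∣ sumφ (suc s) (λ j → sgnφpow (k (suc j))) ∣< φ^ᶻ (ℤ.suc (k 1))
  ∣tail∣<φ^[k₁+1] = subst (∣_∣< _) (sym (sumφ-suc s (λ j → sgnφpow (k (suc j)))))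
    (∣sgnφpow-⊕∣< (k 1) (∣tail∣< s (k ∘ suc) (λ j → sparse (suc j) ∘ s≤s)))

lemma2 : (s : ℕ) → 1 Data.Nat.≤ s → (k : ℕ → ℤ)
    → (∀ j → suc j Data.Nat.< s → k (suc j) + + 2 ≤ k j)
    → ((+ 2 ∣ k 0) → Positive (sumφ s (λ j → sgnφpow (k j))))
      × ((¬ (+ 2 ∣ k 0)) → Negative (sumφ s (λ j → sgnφpow (k j))))
lemma2 (suc s) _ k sparse = positive , negative
  where
  t : ℤφ
  t = sumφ s (λ j → sgnφpow (k (suc j)))
  0<y : Pos (φ^ᶻ (ℤ.pred (k 0)))
  0<y = Pos-φ^ᶻ (ℤ.pred (k 0))
  ∣t∣<y : ∣ t ∣< φ^ᶻ (ℤ.pred (k 0))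
  ∣t∣<y = ∣tail∣< s k sparse
  sum≡ : sumφ (suc s) (λ j → sgnφpow (k j)) ≡ sgnφpow (k 0) ⊕ t
  sum≡ = sumφ-suc s (λ j → sgnφpow (k j))
  positive : + 2 ∣ k 0 → Positive (sumφ (suc s) (λ j → sgnφpow (k j)))
  positive 2∣k₀ = subst Positive (sym (trans sum≡ (sgnφpow-⊕-even (k 0) t 2∣k₀)))
                    (Pos⇒Positive (φ·-dominates 0<y ∣t∣<y))
  negative : ¬ (+ 2 ∣ k 0) → Negative (sumφ (suc s) (λ j → sgnφpow (k j)))
  negative 2∤k₀ = subst Positive (sym (trans (cong neg sum≡) (sgnφpow-⊕-odd (k 0) t 2∤k₀)))
                    (Pos⇒Positive (φ·-dominates 0<y (∣∣<-neg ∣t∣<y)))
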